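{- Let $a>b$ be coprime positive integers and $t\ge 2$ an integer, and call an integer $k$ representable if $k=ua+vb$ for some non-negative integers $u,v$. Suppose integers $l_1<l_2<\dots<l_t$ satisfy: (1) for $1\le i\le t$, $a<\widehat{w_i}:=ab-l_i-1<ab-1$, $l_i$ is not representable and $l_i+1$ is representable; (2) for every $2\le z<t$ and every subset $\{i_1,\dots,i_z\}\subseteq\{1,\dots,t\}$ of cardinality $z$, one has $0<\sum_{j=1}^z l_{i_j}-(z-1)ab<ab$ and this number is not representable; (3) $0<\sum_{j=1}^t l_j+1-(t-1)ab<ab$ and this number is representable. Consider the weighted game with quota $ab$ on $t+b+a$ voters, in which voter 1 has weight $\widehat{w_1}$, voter $i$ has weight $\widehat{w_i}+1$ for $2\le i\le t$, $b$ further voters have weight $a$ and $a$ further voters have weight $b$ (classes of sizes $(1,\dots,1,b,a)$ with $t$ ones). Then for each $k\in\{1,\dots,t\}$, the representation with quota $ab$, weight $\widehat{w_k}$ for voter $k$, weight $\widehat{w_i}+1$ for each voter $i\in\{1,\dots,t\}\setminus\{k\}$, weight $a$ for the next $b$ voters and weight $b$ for the last $a$ voters, is a minimum sum representation preserving types of this game (giving $t$ such representations).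
   Context: A weighted game with quota $q$ and non-negative weights $w_i$ declares a coalition $U$ winning iff $\sum_{i\in U}w_i\ge q$. An integer representation $[q;w_1,\dots,w_n]$ of a game has non-negative integer weights and integer quota such that winning coalitions have weight $\ge q$ and losing ones weight $\le q-1$. The types of voters are the equivalence classes of interchangeable voters. A minimum sum representation preserving types is an integer representation in which voters of the same type have equal weights and whose total weight is minimal among all such integer representations of the game. -}

module Defs where

open import Data.Nat as ℕ using (ℕ; zero; suc)
open import Data.Integer as ℤ using (ℤ; +_; _+_; _-_; _*_; _≤_; _<_)
open import Data.Fin as Fin using (Fin; splitAt; toℕ)
open import Data.Fin.Subset using (Subset; inside; outside; _∪_; ⁅_⁆; _∉_; ⊤)
open import Data.Vec using ([]; _∷_)
open import Data.Sum using (inj₁; inj₂)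
open import Data.Product using (Σ; _×_; ∃₂)
open import Relation.Binary.PropositionalEquality using (_≡_)
open import Relation.Nullary using (¬_; yes; no)
open import Function using (_∘_; _⇔_)

wsum : ∀ {n} → (Fin n → ℤ) → Subset n → ℤ
wsum {zero}  w []            = + 0
wsum {suc n} w (inside ∷ S)  = w Fin.zero + wsum (w ∘ Fin.suc) S
wsum {suc n} w (outside ∷ S) = wsum (w ∘ Fin.suc) S

total : ∀ {n} → (Fin n → ℤ) → ℤ
total w = wsum w ⊤

-- a simple game on n voters: the predicate "coalition is winning"
Game : ℕ → Set₁
Game n = Subset n → Set

weightedGame : ∀ {n} → ℤ → (Fin n → ℤ) → Game n
weightedGame q w S = q ≤ wsum w S

IsIntRep : ∀ {n} → Game n → ℤ → (Fin n → ℤ) → Set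
IsIntRep G q w =
  (∀ i → + 0 ≤ w i) ×
  (∀ S → G S → q ≤ wsum w S) ×
  (∀ S → ¬ G S → wsum w S ≤ q - + 1)

Interchangeable : ∀ {n} → Game n → Fin n → Fin n → Set
Interchangeable G i j =
  ∀ S → i ∉ S → j ∉ S → (G (S ∪ ⁅ i ⁆) ⇔ G (S ∪ ⁅ j ⁆))

PreservesTypes : ∀ {n} → Game n → (Fin n → ℤ) → Set
PreservesTypes G w = ∀ i j → Interchangeable G i j → w i ≡ w j

IsMinSumRepPT : ∀ {n} → Game n → ℤ → (Fin n → ℤ) → Set
IsMinSumRepPT G q w =
  IsIntRep G q w × PreservesTypes G w ×
  (∀ (q' : ℤ) (w' : Fin _ → ℤ) → IsIntRep G q' w' → PreservesTypes G w' →
     total w ≤ total w')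

Representable : ℕ → ℕ → ℤ → Set
Representable a b k = ∃₂ λ (u v : ℕ) → k ≡ + u * + a + + v * + b

what : ℕ → ℕ → ∀ {t} → (Fin t → ℤ) → Fin t → ℤ
what a b l i = + (a ℕ.* b) - l i - + 1

-- weights on t + b + a voters: the first t voters are the special ones,
-- voter with (0-based) index k gets ŵ_k, other special voters i get ŵ_i + 1,
-- then b voters of weight a, then a voters of weight b.
repWeights : (a b t : ℕ) → (Fin t → ℤ) → ℕ → Fin (t ℕ.+ b ℕ.+ a) → ℤ
repWeights a b t l k v with splitAt (t ℕ.+ b) v
... | inj₂ _ = + b
... | inj₁ j with splitAt t j
...   | inj₂ _ = + a
...   | inj₁ m with toℕ m ℕ.≟ k
...     | yes _ = what a b l m
...     | no  _ = what a b l m + + 1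

-- Under each of the t weightings, a coalition with set X of special voters, |Y| voters of weight a
-- and |Z| voters of weight b weighs E − δ, where
-- E = |X| ab − Σ_X l + |Y| a + |Z| b and δ ∈ {0, 1} says whether the decremented voter lies in X.
-- If X is neither empty nor everything, E = ab would make Σ_X l − (|X| − 1) ab representable,
-- against (1) and (2); so the position of the decremented voter never decides a coalition, and all
-- t weightings represent the same game. Different classes of voters are told apart by coalitions
-- built from a representation of lᵢ + 1 (respectively by b − 1 voters of weight a), so types are
-- preserved. Finally, in any type-preserving representation with quota q, weight y on the voters
-- of weight a and z on those of weight b, the winning coalitions of all voters of weight a or of
-- weight b, together with the losing one of weight ab − 1 (which exists since gcd(a, b) = 1), force
-- y ≥ a, z ≥ b and q ≥ ab. The winning coalition of all special voters plus the representation
-- of Σ l + 1 − (t − 1) ab from (3) then bounds the total weight from below by that of ours.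
module Submission where

open import Data.Nat as ℕ using (ℕ; zero; suc; z≤n; s≤s; NonZero)
import Data.Nat.Properties as ℕ
open import Data.Nat.DivMod using (_%_; _/_; m≡m%n+[m/n]*n; m%n<n)
open import Data.Nat.Coprimality using (Coprime; coprime-Bézout)
open import Data.Nat.GCD using (module Bézout)
import Data.Nat.Tactic.RingSolver as ℕ-Solver
open import Data.Product using (∃; ∃₂; _×_; _,_; proj₁; proj₂)
open import Relation.Binary.PropositionalEquality

-- Representations by a and b

module _ where
  open import Data.Nat using (_+_; _*_; _∸_; _≤_; _<_)

  representable-bounds : ∀ {a b} u v → u * a + v * b < a * b → u < b × v < a
  representable-bounds {a} {b} u v lt =
      ℕ.*-cancelʳ-< a u b (ℕ.≤-trans (s≤s (ℕ.m≤m+n (u * a) (v * b)))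
                                     (ℕ.≤-trans lt (ℕ.≤-reflexive (ℕ.*-comm a b))))
    , ℕ.*-cancelʳ-< b v a (ℕ.≤-trans (s≤s (ℕ.m≤n+m (v * b) (u * a))) lt)

  -- If 1 + x a ≡ y b, then u = x mod b has 1 + u a ≡ c b, and ab − 1 = u a + (a − c) b.
  ab∸1-representable-by-Bézout : ∀ a b x y → .{{NonZero a}} → .{{NonZero b}} →
                                 1 + x * a ≡ y * b →
                                 ∃₂ λ u v → u * a + v * b + 1 ≡ a * b
  ab∸1-representable-by-Bézout a b x y eq = u , a ∸ c , (begin
      u * a + (a ∸ c) * b + 1           ≡⟨ cong (λ z → u * a + z + 1) (ℕ.*-distribʳ-∸ b a c) ⟩
      u * a + (a * b ∸ c * b) + 1       ≡⟨ cong (λ z → u * a + (a * b ∸ z) + 1) cb≡1+ua ⟩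
      u * a + (a * b ∸ (1 + u * a)) + 1 ≡⟨ ℕ.+-comm (u * a + _) 1 ⟩
      1 + u * a + (a * b ∸ (1 + u * a)) ≡⟨ ℕ.m+[n∸m]≡n 1+ua≤ab ⟩
      a * b                             ∎)
    where
    open ≡-Reasoning
    u = x % b
    Q = x / b
    c = y ∸ Q * a
    cb≡1+ua : c * b ≡ 1 + u * a
    cb≡1+ua = begin
      (y ∸ Q * a) * b                     ≡⟨ ℕ.*-distribʳ-∸ b y (Q * a) ⟩
      y * b ∸ Q * a * b                   ≡⟨ cong (_∸ Q * a * b) (sym eq) ⟩
      1 + x * a ∸ Q * a * b               ≡⟨ cong (λ z → 1 + z * a ∸ Q * a * b) (m≡m%n+[m/n]*n x b) ⟩
      1 + (u + Q * b) * a ∸ Q * a * b     ≡⟨ cong (_∸ Q * a * b) (expand u Q a b) ⟩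
      (1 + u * a) + Q * a * b ∸ Q * a * b ≡⟨ ℕ.m+n∸n≡m (1 + u * a) (Q * a * b) ⟩
      1 + u * a                           ∎
      where
      expand : ∀ u Q a b → 1 + (u + Q * b) * a ≡ (1 + u * a) + Q * a * b
      expand = ℕ-Solver.solve-∀
    1+ua≤ab : 1 + u * a ≤ a * b
    1+ua≤ab = ℕ.≤-trans (ℕ.+-monoˡ-≤ (u * a) (ℕ.>-nonZero⁻¹ a))
                (ℕ.≤-trans (ℕ.*-monoˡ-≤ a (m%n<n x b)) (ℕ.≤-reflexive (ℕ.*-comm b a)))

  coprime⇒ab∸1-representable : ∀ {a b} .{{_ : NonZero a}} .{{_ : NonZero b}} → Coprime a b →
                               ∃₂ λ u v → u * a + v * b + 1 ≡ a * b
  coprime⇒ab∸1-representable {a} {b} cp with coprime-Bézout cp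
  ... | Bézout.-+ x y eq = ab∸1-representable-by-Bézout a b x y eq
  ... | Bézout.+- x y eq with ab∸1-representable-by-Bézout b a y x eq
  ...   | v , u , e = u , v , trans (cong (_+ 1) (ℕ.+-comm (u * a) (v * b))) (trans e (ℕ.*-comm b a))

open import Defs
open import Data.Integer as ℤ using (ℤ; +_; _+_; _-_; _*_; -_; _≤_; _<_; +≤+; +<+)
import Data.Integer.Properties as ℤ
open import Data.Integer.Tactic.RingSolver using (solve-∀)
open import Algebra.Properties.CommutativeSemigroup ℤ.+-commutativeSemigroup using (interchange)
open import Data.Fin as Fin using (Fin; toℕ; _↑ˡ_; _↑ʳ_; splitAt)
import Data.Fin.Properties as Fin
open import Data.Fin.Subset using (Subset; ∣_∣; inside; outside; _∪_; ⁅_⁆; _∉_; _∈_; ⊤; ⊥)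
import Data.Fin.Subset.Properties as Subset
open import Data.Vec as Vec using ([]; _∷_; _++_; here; there)
open import Data.Empty using (⊥-elim)
open import Data.Sum using (_⊎_; inj₁; inj₂)
open import Function using (_∘_; _⇔_; mk⇔)
open import Function.Bundles using (Equivalence)
import Function.Properties.Equivalence as ⇔
open import Relation.Nullary using (¬_; yes; no)
open import Relation.Binary.Definitions using (tri<; tri≈; tri>)

pos-combination : ∀ u a v b → + u * + a + + v * + b ≡ + (u ℕ.* a ℕ.+ v ℕ.* b)
pos-combination u a v b =
  sym (trans (ℤ.pos-+ (u ℕ.* a) (v ℕ.* b)) (cong₂ _+_ (ℤ.pos-* u a) (ℤ.pos-* v b)))

representable-below : ∀ {a b k} → Representable a b k → k < + (a ℕ.* b) →
                      ∃₂ λ u v → k ≡ + u * + a + + v * + b × u ℕ.< b × v ℕ.< a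
representable-below {a} {b} (u , v , k≡) k<ab
  with subst (_< + (a ℕ.* b)) (trans k≡ (pos-combination u a v b)) k<ab
... | +<+ lt = u , v , k≡ , representable-bounds u v lt

-- Linear inequalities are proved by writing the difference of their two sides, through a ring
-- identity, as a sum of products of quantities already known to be non-negative.
0≤+ : ∀ {x y} → + 0 ≤ x → + 0 ≤ y → + 0 ≤ x + y
0≤+ = ℤ.+-mono-≤

0≤* : ∀ {x y} → + 0 ≤ x → + 0 ≤ y → + 0 ≤ x * y
0≤* {+ m} {+ n} _ _ = subst (+ 0 ≤_) (ℤ.pos-* m n) (+≤+ z≤n)

0≤ℕ : ∀ n → + 0 ≤ + n
0≤ℕ n = +≤+ z≤n

0≤-⇒≤ : ∀ {x y} → + 0 ≤ y - x → x ≤ y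
0≤-⇒≤ = ℤ.0≤i-j⇒j≤i

≤⇒0≤- : ∀ {x y} → x ≤ y → + 0 ≤ y - x
≤⇒0≤- = ℤ.i≤j⇒0≤j-i

ℕ≤⇒0≤- : ∀ {m n} → m ℕ.≤ n → + 0 ≤ + n - + m
ℕ≤⇒0≤- m≤n = ≤⇒0≤- (+≤+ m≤n)

reduce-by : ∀ {x c s s′} k → x ≡ c + k * (s - s′) → s ≡ s′ → x ≡ c
reduce-by {c = c} {s = s} k x≡ refl = trans x≡ (begin
    c + k * (s - s)  ≡⟨ cong (λ e → c + k * e) (ℤ.+-inverseʳ s) ⟩
    c + k * + 0      ≡⟨ cong (λ e → c + e) (ℤ.*-zeroʳ k) ⟩
    c + + 0          ≡⟨ ℤ.+-identityʳ c ⟩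
    c                ∎)
  where open ≡-Reasoning

<⇒≤-1 : ∀ {x y} → x < y → x ≤ y - + 1
<⇒≤-1 {y = y} x<y = subst (_ ≤_) (ℤ.+-comm (- + 1) y) (ℤ.i<j⇒i≤pred[j] x<y)

≤-minus-bit : ∀ {q E d} → E ≢ q → d ≡ + 0 ⊎ d ≡ + 1 → q ≤ E - d ⇔ q ≤ E
≤-minus-bit {q} {E} _   (inj₁ refl) =
  mk⇔ (subst (q ≤_) (ℤ.+-identityʳ E)) (subst (q ≤_) (sym (ℤ.+-identityʳ E)))
≤-minus-bit {q} {E} E≢q (inj₂ refl) =
  mk⇔ (λ q≤E-1 → ℤ.≤-trans q≤E-1 (ℤ.i-j≤i E (+ 1)))
      (λ q≤E → <⇒≤-1 (ℤ.≤∧≢⇒< q≤E (E≢q ∘ sym)))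

-- The two winning and the one losing constraint are combined with the multipliers
-- (a − v₀, v₀), (u₀, b − u₀) and (1, u₀, v₀) respectively.
forced-bounds : ∀ {a b u₀ v₀ : ℕ} {q y z : ℤ} → u₀ ℕ.* a ℕ.+ v₀ ℕ.* b ℕ.+ 1 ≡ a ℕ.* b →
                q ≤ + b * y → q ≤ + a * z → + u₀ * y + + v₀ * z ≤ q - + 1 →
                + a ≤ y × + b ≤ z × + a * + b ≤ q
forced-bounds {a} {b} {u₀} {v₀} {q} {y} {z} rel c₁ c₂ c₃ = a≤y , b≤z , ab≤q
  where
  A = + a ; B = + b ; U = + u₀ ; V = + v₀
  rel′ : U * A + V * B + + 1 ≡ A * B
  rel′ = trans (cong (_+ + 1) (pos-combination u₀ a v₀ b)) (trans (cong +_ rel) (ℤ.pos-* a b))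
  bounds = representable-bounds u₀ v₀
             (subst (u₀ ℕ.* a ℕ.+ v₀ ℕ.* b ℕ.<_) rel (ℕ.m<m+n _ ℕ.0<1+n))
  u₀≤b = ℕ.<⇒≤ (proj₁ bounds)
  v₀≤a = ℕ.<⇒≤ (proj₂ bounds)
  d₁ = ≤⇒0≤- c₁
  d₂ = ≤⇒0≤- c₂
  d₃ = ≤⇒0≤- c₃
  a≤y : A ≤ y
  a≤y = 0≤-⇒≤ (subst (+ 0 ≤_) (sym (reduce-by y (identity A B U V q y z) rel′))
          (0≤+ (0≤* (ℕ≤⇒0≤- v₀≤a) (0≤+ d₁ d₃)) (0≤* (0≤ℕ v₀) (0≤+ d₂ d₃))))
    where
    identity : ∀ A B U V q y z → y - A ≡
      (A - V) * ((B * y - q) + (q - + 1 - (U * y + V * z)))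
        + V * ((A * z - q) + (q - + 1 - (U * y + V * z)))
        + y * (U * A + V * B + + 1 - A * B)
    identity = solve-∀
  b≤z : B ≤ z
  b≤z = 0≤-⇒≤ (subst (+ 0 ≤_) (sym (reduce-by z (identity A B U V q y z) rel′))
          (0≤+ (0≤* (0≤ℕ u₀) (0≤+ d₁ d₃)) (0≤* (ℕ≤⇒0≤- u₀≤b) (0≤+ d₂ d₃))))
    where
    identity : ∀ A B U V q y z → z - B ≡
      U * ((B * y - q) + (q - + 1 - (U * y + V * z)))
        + (B - U) * ((A * z - q) + (q - + 1 - (U * y + V * z)))
        + z * (U * A + V * B + + 1 - A * B)
    identity = solve-∀
  ab≤q : A * B ≤ q
  ab≤q = 0≤-⇒≤ (subst (+ 0 ≤_) (sym (reduce-by (+ 1) (identity A B U V q y z) rel′))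
           (0≤+ (0≤+ d₃ (0≤* (0≤ℕ u₀) (≤⇒0≤- a≤y))) (0≤* (0≤ℕ v₀) (≤⇒0≤- b≤z))))
    where
    identity : ∀ A B U V q y z → q - A * B ≡
      (q - + 1 - (U * y + V * z)) + U * (y - A) + V * (z - B)
        + + 1 * (U * A + V * B + + 1 - A * B)
    identity = solve-∀

total-bound : ∀ {a b u v : ℕ} {q y z X : ℤ} →
              + a ≤ y → + b ≤ z → + a * + b ≤ q → u ℕ.≤ b → v ℕ.≤ a →
              q ≤ X + (+ u * y + + v * z) →
              + a * + b - (+ u * + a + + v * + b) + (+ b * + a + + a * + b) ≤ X + (+ b * y + + a * z)
total-bound {a} {b} {u} {v} {q} {y} {z} {X} a≤y b≤z ab≤q u≤b v≤a c =
  0≤-⇒≤ (subst (+ 0 ≤_) (sym (identity (+ a) (+ b) (+ u) (+ v) q y z X))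
    (0≤+ (0≤+ (0≤+ (≤⇒0≤- c) (≤⇒0≤- ab≤q)) (0≤* (ℕ≤⇒0≤- u≤b) (≤⇒0≤- a≤y)))
         (0≤* (ℕ≤⇒0≤- v≤a) (≤⇒0≤- b≤z))))
  where
  identity : ∀ A B U V q y z X →
    X + (B * y + A * z) - (A * B - (U * A + V * B) + (B * A + A * B)) ≡
    (X + (U * y + V * z) - q) + (q - A * B) + (B - U) * (y - A) + (A - V) * (z - B)
  identity = solve-∀

-- Subsets

∣p∣≡0⇒p≡⊥ : ∀ {n} {p : Subset n} → ∣ p ∣ ≡ 0 → p ≡ ⊥
∣p∣≡0⇒p≡⊥ {p = []}          _ = refl
∣p∣≡0⇒p≡⊥ {p = outside ∷ p} e = cong (outside ∷_) (∣p∣≡0⇒p≡⊥ e)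

∣p∣≡1⇒p≡⁅x⁆ : ∀ {n} {p : Subset n} → ∣ p ∣ ≡ 1 → ∃ λ x → p ≡ ⁅ x ⁆
∣p∣≡1⇒p≡⁅x⁆ {p = inside ∷ p}  e =
  Fin.zero , cong (inside ∷_) (∣p∣≡0⇒p≡⊥ (ℕ.suc-injective e))
∣p∣≡1⇒p≡⁅x⁆ {p = outside ∷ p} e with ∣p∣≡1⇒p≡⁅x⁆ {p = p} e
... | x , p≡⁅x⁆ = Fin.suc x , cong (outside ∷_) p≡⁅x⁆

⊥⊎⊤⊎proper : ∀ {n} (p : Subset n) → p ≡ ⊥ ⊎ p ≡ ⊤ ⊎ (0 ℕ.< ∣ p ∣ × ∣ p ∣ ℕ.< n)
⊥⊎⊤⊎proper {n} p with ∣ p ∣ ℕ.≟ 0 | ∣ p ∣ ℕ.≟ n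
... | yes e | _     = inj₁ (∣p∣≡0⇒p≡⊥ e)
... | no _  | yes e = inj₂ (inj₁ (Subset.∣p∣≡n⇒p≡⊤ e))
... | no ≢0 | no ≢n = inj₂ (inj₂ (ℕ.n≢0⇒n>0 ≢0 , ℕ.≤∧≢⇒< (Subset.∣p∣≤n p) ≢n))

prefix : ∀ n → ℕ → Subset n
prefix zero    _       = []
prefix (suc n) zero    = outside ∷ prefix n zero
prefix (suc n) (suc c) = inside ∷ prefix n c

∣prefix∣ : ∀ {n c} → c ℕ.≤ n → ∣ prefix n c ∣ ≡ c
∣prefix∣ {zero}  z≤n     = refl
∣prefix∣ {suc n} z≤n     = ∣prefix∣ {n} z≤n
∣prefix∣ {suc n} (s≤s p) = cong suc (∣prefix∣ p)

avoiding : ∀ {n} → Fin n → ℕ → Subset n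
avoiding         _           zero    = ⊥
avoiding {suc n} Fin.zero    (suc c) = outside ∷ prefix n (suc c)
avoiding         (Fin.suc x) (suc c) = inside ∷ avoiding x c

∣avoiding∣ : ∀ {n} (x : Fin n) {c} → c ℕ.< n → ∣ avoiding x c ∣ ≡ c
∣avoiding∣ {n} _       {zero}  _       = Subset.∣⊥∣≡0 n
∣avoiding∣ Fin.zero    {suc c} (s≤s p) = ∣prefix∣ p
∣avoiding∣ (Fin.suc x) {suc c} (s≤s p) = cong suc (∣avoiding∣ x p)

x∉avoiding : ∀ {n} (x : Fin n) c → x ∉ avoiding x c
x∉avoiding x           zero              = Subset.∉⊥
x∉avoiding (Fin.suc x) (suc c) (there p) = x∉avoiding x c p

∈-++⁻ˡ : ∀ {m n} {i : Fin m} (X : Subset m) (Y : Subset n) → (i ↑ˡ n) ∈ (X ++ Y) → i ∈ X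
∈-++⁻ˡ {i = Fin.zero}  (x ∷ X) Y here      = here
∈-++⁻ˡ {i = Fin.suc i} (x ∷ X) Y (there p) = there (∈-++⁻ˡ X Y p)

∈-++⁻ʳ : ∀ {m n} {j : Fin n} (X : Subset m) (Y : Subset n) → (m ↑ʳ j) ∈ (X ++ Y) → j ∈ Y
∈-++⁻ʳ []      Y p         = p
∈-++⁻ʳ (x ∷ X) Y (there p) = ∈-++⁻ʳ X Y p

⊤-++ : ∀ m n → ⊤ {m ℕ.+ n} ≡ ⊤ {m} ++ ⊤ {n}
⊤-++ zero    n = refl
⊤-++ (suc m) n = cong (inside ∷_) (⊤-++ m n)

-- Sums over coalitions

wsum-cong : ∀ {n} {f g : Fin n → ℤ} → (∀ i → f i ≡ g i) → ∀ S → wsum f S ≡ wsum g S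
wsum-cong e []            = refl
wsum-cong e (inside ∷ S)  = cong₂ _+_ (e Fin.zero) (wsum-cong (e ∘ Fin.suc) S)
wsum-cong e (outside ∷ S) = wsum-cong (e ∘ Fin.suc) S

wsum-⊥ : ∀ {n} (f : Fin n → ℤ) → wsum f ⊥ ≡ + 0
wsum-⊥ {zero}  f = refl
wsum-⊥ {suc n} f = wsum-⊥ (f ∘ Fin.suc)

wsum-⁅⁆ : ∀ {n} (w : Fin n → ℤ) i → wsum w ⁅ i ⁆ ≡ w i
wsum-⁅⁆ w Fin.zero    = trans (cong (λ s → w Fin.zero + s) (wsum-⊥ (w ∘ Fin.suc))) (ℤ.+-identityʳ _)
wsum-⁅⁆ w (Fin.suc i) = wsum-⁅⁆ (w ∘ Fin.suc) i

wsum-const : ∀ {n} {f : Fin n → ℤ} {c} → (∀ i → f i ≡ c) → ∀ S → wsum f S ≡ + ∣ S ∣ * c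
wsum-const {c = c} e []    = sym (ℤ.*-zeroˡ c)
wsum-const e (inside ∷ S)  =
  trans (cong₂ _+_ (e Fin.zero) (wsum-const (e ∘ Fin.suc) S)) (sym (ℤ.suc-* (+ ∣ S ∣) _))
wsum-const e (outside ∷ S) = wsum-const (e ∘ Fin.suc) S

wsum-+ : ∀ {n} (f g : Fin n → ℤ) S → wsum (λ i → f i + g i) S ≡ wsum f S + wsum g S
wsum-+ f g []            = refl
wsum-+ f g (inside ∷ S)  =
  trans (cong (λ s → f Fin.zero + g Fin.zero + s) (wsum-+ (f ∘ Fin.suc) (g ∘ Fin.suc) S))
        (interchange (f Fin.zero) (g Fin.zero) (wsum (f ∘ Fin.suc) S) (wsum (g ∘ Fin.suc) S))
wsum-+ f g (outside ∷ S) = wsum-+ (f ∘ Fin.suc) (g ∘ Fin.suc) S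

wsum-neg : ∀ {n} (f : Fin n → ℤ) S → wsum (λ i → - f i) S ≡ - wsum f S
wsum-neg f []            = refl
wsum-neg f (inside ∷ S)  =
  trans (cong (λ s → - f Fin.zero + s) (wsum-neg (f ∘ Fin.suc) S))
        (sym (ℤ.neg-distrib-+ (f Fin.zero) (wsum (f ∘ Fin.suc) S)))
wsum-neg f (outside ∷ S) = wsum-neg (f ∘ Fin.suc) S

wsum-++ : ∀ {m n} (w : Fin (m ℕ.+ n) → ℤ) (X : Subset m) (Y : Subset n) →
          wsum w (X ++ Y) ≡ wsum (w ∘ (_↑ˡ n)) X + wsum (w ∘ (m ↑ʳ_)) Y
wsum-++ w []            Y = sym (ℤ.+-identityˡ _)
wsum-++ w (inside ∷ X)  Y =
  trans (cong (λ s → w Fin.zero + s) (wsum-++ (w ∘ Fin.suc) X Y))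
        (sym (ℤ.+-assoc (w Fin.zero) _ _))
wsum-++ w (outside ∷ X) Y = wsum-++ (w ∘ Fin.suc) X Y

wsum-∪⁅⁆ : ∀ {n} (w : Fin n → ℤ) S {i} → i ∉ S → wsum w (S ∪ ⁅ i ⁆) ≡ wsum w S + w i
wsum-∪⁅⁆ w (inside ∷ S)  {Fin.zero}  i∉S = ⊥-elim (i∉S here)
wsum-∪⁅⁆ w (outside ∷ S) {Fin.zero}  _   =
  trans (cong (λ T → w Fin.zero + wsum (w ∘ Fin.suc) T) (Subset.∪-identityʳ S))
        (ℤ.+-comm (w Fin.zero) _)
wsum-∪⁅⁆ w (inside ∷ S)  {Fin.suc i} i∉S =
  trans (cong (λ s → w Fin.zero + s) (wsum-∪⁅⁆ (w ∘ Fin.suc) S (i∉S ∘ there)))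
        (sym (ℤ.+-assoc (w Fin.zero) _ _))
wsum-∪⁅⁆ w (outside ∷ S) {Fin.suc i} i∉S = wsum-∪⁅⁆ (w ∘ Fin.suc) S (i∉S ∘ there)

wsum-zero : ∀ {n} (f : Fin n → ℤ) S → (∀ j → j ∈ S → f j ≡ + 0) → wsum f S ≡ + 0
wsum-zero f []            _ = refl
wsum-zero f (inside ∷ S)  z =
  cong₂ _+_ (z Fin.zero here) (wsum-zero (f ∘ Fin.suc) S (λ j → z (Fin.suc j) ∘ there))
wsum-zero f (outside ∷ S) z = wsum-zero (f ∘ Fin.suc) S (λ j → z (Fin.suc j) ∘ there)

wsum-point-∉ : ∀ {n} (f : Fin n → ℤ) {i} → (∀ j → j ≢ i → f j ≡ + 0) →
               ∀ {S} → i ∉ S → wsum f S ≡ + 0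
wsum-point-∉ f supp {S} i∉S = wsum-zero f S (λ j j∈S → supp j (λ { refl → i∉S j∈S }))

supp-suc : ∀ {n} {f : Fin (suc n) → ℤ} {i} → (∀ j → j ≢ Fin.suc i → f j ≡ + 0) →
           ∀ j → j ≢ i → f (Fin.suc j) ≡ + 0
supp-suc supp j j≢i = supp (Fin.suc j) (j≢i ∘ Fin.suc-injective)

wsum-point-∈ : ∀ {n} (f : Fin n → ℤ) {i} → (∀ j → j ≢ i → f j ≡ + 0) →
               ∀ {S} → i ∈ S → wsum f S ≡ f i
wsum-point-∈ f {Fin.zero}  supp {inside ∷ S}  here      =
  trans (cong (λ s → f Fin.zero + s) (wsum-zero (f ∘ Fin.suc) S (λ j _ → supp (Fin.suc j) (λ ()))))
        (ℤ.+-identityʳ _)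
wsum-point-∈ f {Fin.suc i} supp {inside ∷ S}  (there p) =
  trans (cong₂ _+_ (supp Fin.zero (λ ())) (wsum-point-∈ (f ∘ Fin.suc) (supp-suc supp) p))
        (ℤ.+-identityˡ _)
wsum-point-∈ f {Fin.suc i} supp {outside ∷ S} (there p) =
  wsum-point-∈ (f ∘ Fin.suc) (supp-suc supp) p

-- Weighted games

Interchangeable-sym : ∀ {n} (G : Game n) {i j} → Interchangeable G i j → Interchangeable G j i
Interchangeable-sym G i~j S j∉S i∉S = ⇔.sym (i~j S i∉S j∉S)

weightedGame-interchangeable : ∀ {n} q (w : Fin n → ℤ) {i j} → w i ≡ w j →
                               Interchangeable (weightedGame q w) i j
weightedGame-interchangeable q w wi≡wj S i∉S j∉S =
  mk⇔ (swap-voter wi≡wj i∉S j∉S) (swap-voter (sym wi≡wj) j∉S i∉S)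
  where
  swap-voter : ∀ {i j} → w i ≡ w j → i ∉ S → j ∉ S →
               q ≤ wsum w (S ∪ ⁅ i ⁆) → q ≤ wsum w (S ∪ ⁅ j ⁆)
  swap-voter e i∉S j∉S = subst (q ≤_)
    (trans (wsum-∪⁅⁆ w S i∉S) (trans (cong (λ s → wsum w S + s) e) (sym (wsum-∪⁅⁆ w S j∉S))))

separated⇒¬interchangeable : ∀ {n} q (w : Fin n → ℤ) {i j} S → i ∉ S → j ∉ S →
                             q ≤ wsum w S + w i → wsum w S + w j < q →
                             ¬ Interchangeable (weightedGame q w) i j
separated⇒¬interchangeable q w S i∉S j∉S win lose i~j =
  ℤ.<⇒≱ lose (subst (q ≤_) (wsum-∪⁅⁆ w S j∉S)
    (Equivalence.to (i~j S i∉S j∉S) (subst (q ≤_) (sym (wsum-∪⁅⁆ w S i∉S)) win)))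

weightedGame-isIntRep : ∀ {n} q (w₀ w : Fin n → ℤ) → (∀ i → + 0 ≤ w i) →
                        (∀ S → q ≤ wsum w₀ S → q ≤ wsum w S) →
                        (∀ S → q ≤ wsum w S → q ≤ wsum w₀ S) →
                        IsIntRep (weightedGame q w₀) q w
weightedGame-isIntRep q w₀ w w≥0 to from =
  w≥0 , to , λ S lose → <⇒≤-1 (ℤ.≰⇒> (lose ∘ from S))

-- The game of the theorem

module Theorem4Game (a b t : ℕ) (l : Fin t → ℤ) where

  ab : ℤ
  ab = + (a ℕ.* b)

  N : ℕ
  N = t ℕ.+ b ℕ.+ a

  special : Fin t → Fin N
  special m = (m ↑ˡ b) ↑ˡ a

  aVoter : Fin b → Fin N
  aVoter x = (t ↑ʳ x) ↑ˡ a

  bVoter : Fin a → Fin N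
  bVoter x = (t ℕ.+ b) ↑ʳ x

  data Voter : Fin N → Set where
    special′ : ∀ m → Voter (special m)
    aVoter′  : ∀ x → Voter (aVoter x)
    bVoter′  : ∀ x → Voter (bVoter x)

  voter : ∀ v → Voter v
  voter v with splitAt (t ℕ.+ b) v in eq
  ... | inj₂ x = subst Voter (Fin.splitAt⁻¹-↑ʳ eq) (bVoter′ x)
  ... | inj₁ j with splitAt t j in eq′
  ...   | inj₁ m = subst Voter (trans (cong (_↑ˡ a) (Fin.splitAt⁻¹-↑ˡ eq′)) (Fin.splitAt⁻¹-↑ˡ eq))
                         (special′ m)
  ...   | inj₂ x = subst Voter (trans (cong (_↑ˡ a) (Fin.splitAt⁻¹-↑ʳ eq′)) (Fin.splitAt⁻¹-↑ˡ eq))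
                         (aVoter′ x)

  coalition : Subset t → Subset b → Subset a → Subset N
  coalition X Y Z = (X ++ Y) ++ Z

  coalition-elim : ∀ {P : Subset N → Set} → (∀ X Y Z → P (coalition X Y Z)) → ∀ S → P S
  coalition-elim f S with Vec.splitAt (t ℕ.+ b) S
  ... | XY , Z , refl with Vec.splitAt t XY
  ...   | X , Y , refl = f X Y Z

  ⊤≡coalition : ⊤ ≡ coalition ⊤ ⊤ ⊤
  ⊤≡coalition = trans (⊤-++ (t ℕ.+ b) a) (cong (_++ ⊤) (⊤-++ t b))

  special∉ : ∀ m Y Z → special m ∉ coalition ⊥ Y Z
  special∉ m Y Z = Subset.∉⊥ ∘ ∈-++⁻ˡ ⊥ Y ∘ ∈-++⁻ˡ (⊥ ++ Y) Z

  aVoter∉ : ∀ {x} X Y Z → x ∉ Y → aVoter x ∉ coalition X Y Z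
  aVoter∉ X Y Z x∉Y = x∉Y ∘ ∈-++⁻ʳ X Y ∘ ∈-++⁻ˡ (X ++ Y) Z

  bVoter∉ : ∀ {x} X Y Z → x ∉ Z → bVoter x ∉ coalition X Y Z
  bVoter∉ X Y Z x∉Z = x∉Z ∘ ∈-++⁻ʳ (X ++ Y) Z

  module _ (w : Fin N → ℤ) {y z} (w-a : ∀ x → w (aVoter x) ≡ y) (w-b : ∀ x → w (bVoter x) ≡ z)
    where

    wsum-coalition : ∀ X Y Z →
                     wsum w (coalition X Y Z) ≡ wsum (w ∘ special) X + (+ ∣ Y ∣ * y + + ∣ Z ∣ * z)
    wsum-coalition X Y Z = begin
      wsum w ((X ++ Y) ++ Z)
        ≡⟨ wsum-++ w (X ++ Y) Z ⟩
      wsum (w ∘ (_↑ˡ a)) (X ++ Y) + wsum (w ∘ bVoter) Z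
        ≡⟨ cong₂ _+_ (wsum-++ (w ∘ (_↑ˡ a)) X Y) (wsum-const w-b Z) ⟩
      wsum (w ∘ special) X + wsum (w ∘ aVoter) Y + + ∣ Z ∣ * z
        ≡⟨ cong (λ s → wsum (w ∘ special) X + s + + ∣ Z ∣ * z) (wsum-const w-a Y) ⟩
      wsum (w ∘ special) X + + ∣ Y ∣ * y + + ∣ Z ∣ * z
        ≡⟨ ℤ.+-assoc (wsum (w ∘ special) X) _ _ ⟩
      wsum (w ∘ special) X + (+ ∣ Y ∣ * y + + ∣ Z ∣ * z) ∎
      where open ≡-Reasoning

    wsum-coalition-⊥ : ∀ Y Z → wsum w (coalition ⊥ Y Z) ≡ + ∣ Y ∣ * y + + ∣ Z ∣ * z
    wsum-coalition-⊥ Y Z = trans (wsum-coalition ⊥ Y Z)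
      (trans (cong (λ s → s + (+ ∣ Y ∣ * y + + ∣ Z ∣ * z)) (wsum-⊥ (w ∘ special)))
             (ℤ.+-identityˡ _))

    wsum-coalition-prefix : ∀ X {u v} → u ℕ.≤ b → v ℕ.≤ a →
                            wsum w (coalition X (prefix b u) (prefix a v))
                              ≡ wsum (w ∘ special) X + (+ u * y + + v * z)
    wsum-coalition-prefix X u≤b v≤a = trans (wsum-coalition X (prefix b _) (prefix a _))
      (cong₂ (λ c d → wsum (w ∘ special) X + (+ c * y + + d * z)) (∣prefix∣ u≤b) (∣prefix∣ v≤a))

    total-coalition : total w ≡ wsum (w ∘ special) ⊤ + (+ b * y + + a * z)
    total-coalition = trans (cong (wsum w) ⊤≡coalition) (trans (wsum-coalition ⊤ ⊤ ⊤)
      (cong₂ (λ c d → wsum (w ∘ special) ⊤ + (+ c * y + + d * z))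
             (Subset.∣⊤∣≡n b) (Subset.∣⊤∣≡n a)))

  -- W K is the representation of the theorem for k = K; the theorem's game is game Fin.zero.
  W : Fin t → Fin N → ℤ
  W K = repWeights a b t l (toℕ K)

  game : Fin t → Game N
  game K = weightedGame ab (W K)

  W-aVoter : ∀ K x → W K (aVoter x) ≡ + a
  W-aVoter K x rewrite Fin.splitAt-↑ˡ (t ℕ.+ b) (t ↑ʳ x) a | Fin.splitAt-↑ʳ t b x = refl

  W-bVoter : ∀ K x → W K (bVoter x) ≡ + b
  W-bVoter K x rewrite Fin.splitAt-↑ʳ (t ℕ.+ b) a x = refl

  W-special-bounds : ∀ K m → what a b l m ≤ W K (special m) × W K (special m) ≤ what a b l m + + 1
  W-special-bounds K m rewrite Fin.splitAt-↑ˡ (t ℕ.+ b) (m ↑ˡ b) a | Fin.splitAt-↑ˡ t m b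
    with toℕ m ℕ.≟ toℕ K
  ... | yes _ = ℤ.≤-refl , ℤ.i≤i+j _ (+ 1)
  ... | no  _ = ℤ.i≤i+j _ (+ 1) , ℤ.≤-refl

  δ : Fin t → Fin t → ℤ
  δ K m with toℕ m ℕ.≟ toℕ K
  ... | yes _ = + 1
  ... | no  _ = + 0

  W-special : ∀ K m → W K (special m) ≡ ab - l m - δ K m
  W-special K m rewrite Fin.splitAt-↑ˡ (t ℕ.+ b) (m ↑ˡ b) a | Fin.splitAt-↑ˡ t m b
    with toℕ m ℕ.≟ toℕ K
  ... | yes _ = refl
  ... | no  _ = undo-decrement ab (l m)
    where
    undo-decrement : ∀ A L → A - L - + 1 + + 1 ≡ A - L - + 0
    undo-decrement = solve-∀

  δ-self : ∀ K → δ K K ≡ + 1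
  δ-self K with toℕ K ℕ.≟ toℕ K
  ... | yes _   = refl
  ... | no  K≢K = ⊥-elim (K≢K refl)

  δ-other : ∀ K m → m ≢ K → δ K m ≡ + 0
  δ-other K m m≢K with toℕ m ℕ.≟ toℕ K
  ... | yes eq = ⊥-elim (m≢K (Fin.toℕ-injective eq))
  ... | no  _  = refl

  wsum-δ-∈ : ∀ {K X} → K ∈ X → wsum (δ K) X ≡ + 1
  wsum-δ-∈ {K} K∈X = trans (wsum-point-∈ (δ K) (δ-other K) K∈X) (δ-self K)

  wsum-δ-bit : ∀ K X → wsum (δ K) X ≡ + 0 ⊎ wsum (δ K) X ≡ + 1
  wsum-δ-bit K X with K Subset.∈? X
  ... | yes K∈X = inj₂ (wsum-δ-∈ K∈X)
  ... | no  K∉X = inj₁ (wsum-point-∉ (δ K) (δ-other K) K∉X)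

  weight⁺ : Subset t → Subset b → Subset a → ℤ
  weight⁺ X Y Z = + ∣ X ∣ * ab - wsum l X + (+ ∣ Y ∣ * + a + + ∣ Z ∣ * + b)

  wsum-W-special : ∀ K X → wsum (W K ∘ special) X ≡ + ∣ X ∣ * ab - wsum l X - wsum (δ K) X
  wsum-W-special K X = begin
    wsum (W K ∘ special) X                              ≡⟨ wsum-cong (W-special K) X ⟩
    wsum (λ m → (ab + - l m) + - δ K m) X               ≡⟨ wsum-+ _ _ X ⟩
    wsum (λ m → ab + - l m) X + wsum (λ m → - δ K m) X
      ≡⟨ cong₂ _+_ (wsum-+ _ _ X) (wsum-neg (δ K) X) ⟩
    wsum (λ _ → ab) X + wsum (λ m → - l m) X + - wsum (δ K) X
      ≡⟨ cong₂ (λ c d → c + d - wsum (δ K) X) (wsum-const (λ _ → refl) X) (wsum-neg l X) ⟩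
    + ∣ X ∣ * ab - wsum l X - wsum (δ K) X              ∎
    where open ≡-Reasoning

  wsum-W : ∀ K X Y Z → wsum (W K) (coalition X Y Z) ≡ weight⁺ X Y Z - wsum (δ K) X
  wsum-W K X Y Z = begin
    wsum (W K) (coalition X Y Z)                ≡⟨ wsum-coalition (W K) (W-aVoter K) (W-bVoter K) X Y Z ⟩
    wsum (W K ∘ special) X + n                  ≡⟨ cong (_+ n) (wsum-W-special K X) ⟩
    + ∣ X ∣ * ab - wsum l X - wsum (δ K) X + n
      ≡⟨ move-δ (+ ∣ X ∣ * ab) (wsum l X) (wsum (δ K) X) n ⟩
    weight⁺ X Y Z - wsum (δ K) X                ∎
    where
    open ≡-Reasoning
    n = + ∣ Y ∣ * + a + + ∣ Z ∣ * + b
    move-δ : ∀ P L D n → P - L - D + n ≡ P - L + n - D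
    move-δ = solve-∀

  W-nonNeg : (∀ m → + 0 ≤ what a b l m) → ∀ K v → + 0 ≤ W K v
  W-nonNeg ŵ≥0 K v with voter v
  ... | special′ m = ℤ.≤-trans (ŵ≥0 m) (proj₁ (W-special-bounds K m))
  ... | aVoter′  x = subst (+ 0 ≤_) (sym (W-aVoter K x)) (0≤ℕ a)
  ... | bVoter′  x = subst (+ 0 ≤_) (sym (W-bVoter K x)) (0≤ℕ b)

  ProperSumsNonRepresentable : Set
  ProperSumsNonRepresentable =
    ∀ X → 0 ℕ.< ∣ X ∣ → ∣ X ∣ ℕ.< t → ¬ Representable a b (wsum l X - (+ ∣ X ∣ - + 1) * ab)

  properSums-nonRepresentable :
    (∀ i → ¬ Representable a b (l i)) →
    (∀ X → 2 ℕ.≤ ∣ X ∣ → ∣ X ∣ ℕ.< t →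
       ¬ Representable a b (wsum l X - (+ ∣ X ∣ - + 1) * ab)) →
    ProperSumsNonRepresentable
  properSums-nonRepresentable l-nonrep sums-nonrep X 0<∣X∣ ∣X∣<t with ∣ X ∣ ℕ.≟ 1
  ... | no ∣X∣≢1 = sums-nonrep X (ℕ.≤∧≢⇒< 0<∣X∣ (∣X∣≢1 ∘ sym)) ∣X∣<t
  ... | yes ∣X∣≡1 with ∣p∣≡1⇒p≡⁅x⁆ {p = X} ∣X∣≡1
  ...   | i , refl = l-nonrep i ∘ subst (Representable a b) single-sum
    where
    single-sum : wsum l ⁅ i ⁆ - (+ ∣ ⁅ i ⁆ ∣ - + 1) * ab ≡ l i
    single-sum = trans (cong (λ c → wsum l ⁅ i ⁆ - (+ c - + 1) * ab) ∣X∣≡1)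
                       (trans (ℤ.+-identityʳ _) (wsum-⁅⁆ l i))

  module _ (nonrep : ProperSumsNonRepresentable) where

    weight⁺≢ab : ∀ X Y Z → 0 ℕ.< ∣ X ∣ → ∣ X ∣ ℕ.< t → weight⁺ X Y Z ≢ ab
    weight⁺≢ab X Y Z 0<∣X∣ ∣X∣<t eq = nonrep X 0<∣X∣ ∣X∣<t
      (∣ Y ∣ , ∣ Z ∣ , reduce-by (- + 1) (identity (+ ∣ X ∣) (wsum l X) n ab) eq)
      where
      n = + ∣ Y ∣ * + a + + ∣ Z ∣ * + b
      identity : ∀ c L n A → L - (c - + 1) * A ≡ n + - + 1 * (c * A - L + n - A)
      identity = solve-∀

    -- For X = ⊥ and X = ⊤ the term δ is the same for every K; otherwise weight⁺ ≢ ab, and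
    -- subtracting δ ∈ {0, 1} cannot carry the weight across the quota.
    W-sameWins : ∀ K K′ S → ab ≤ wsum (W K) S → ab ≤ wsum (W K′) S
    W-sameWins K K′ = coalition-elim same
      where
      same : ∀ X Y Z → ab ≤ wsum (W K) (coalition X Y Z) → ab ≤ wsum (W K′) (coalition X Y Z)
      same X Y Z win rewrite wsum-W K X Y Z | wsum-W K′ X Y Z with ⊥⊎⊤⊎proper X
      ... | inj₁ refl =
        subst (λ d → ab ≤ weight⁺ ⊥ Y Z - d) (trans (wsum-⊥ (δ K)) (sym (wsum-⊥ (δ K′)))) win
      ... | inj₂ (inj₁ refl) =
        subst (λ d → ab ≤ weight⁺ ⊤ Y Z - d)
              (trans (wsum-δ-∈ Subset.∈⊤) (sym (wsum-δ-∈ Subset.∈⊤))) win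
      ... | inj₂ (inj₂ (0<∣X∣ , ∣X∣<t)) =
        Equivalence.from (≤-minus-bit ≢ab (wsum-δ-bit K′ X))
          (Equivalence.to (≤-minus-bit ≢ab (wsum-δ-bit K X)) win)
        where ≢ab = weight⁺≢ab X Y Z 0<∣X∣ ∣X∣<t

    W-isIntRep : (∀ m → + 0 ≤ what a b l m) → ∀ K₀ K → IsIntRep (game K₀) ab (W K)
    W-isIntRep ŵ≥0 K₀ K =
      weightedGame-isIntRep ab (W K₀) (W K) (W-nonNeg ŵ≥0 K) (W-sameWins K₀ K) (W-sameWins K K₀)

  l+1+ŵ≡ab : ∀ m → l m + + 1 + what a b l m ≡ ab
  l+1+ŵ≡ab m = identity ab (l m)
    where
    identity : ∀ A L → L + + 1 + (A - L - + 1) ≡ A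
    identity = solve-∀

  special-separated : ∀ K₀ m {j u v} (Y : Subset b) (Z : Subset a) →
                      l m + + 1 ≡ + u * + a + + v * + b → ∣ Y ∣ ≡ u → ∣ Z ∣ ≡ v →
                      j ∉ coalition ⊥ Y Z → l m + + 1 + W K₀ j < ab →
                      ¬ Interchangeable (game K₀) (special m) j
  special-separated K₀ m {j} Y Z l+1≡ ∣Y∣≡u ∣Z∣≡v j∉ light =
    separated⇒¬interchangeable ab (W K₀) (coalition ⊥ Y Z) (special∉ m Y Z) j∉
      (subst (λ s → ab ≤ s + W K₀ (special m)) (sym weight) win)
      (subst (λ s → s + W K₀ j < ab) (sym weight) light)
    where
    weight : wsum (W K₀) (coalition ⊥ Y Z) ≡ l m + + 1
    weight = trans (wsum-coalition-⊥ (W K₀) (W-aVoter K₀) (W-bVoter K₀) Y Z)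
                   (trans (cong₂ (λ c d → + c * + a + + d * + b) ∣Y∣≡u ∣Z∣≡v) (sym l+1≡))
    win : ab ≤ l m + + 1 + W K₀ (special m)
    win = ℤ.≤-trans (ℤ.≤-reflexive (sym (l+1+ŵ≡ab m)))
                    (ℤ.+-monoʳ-≤ (l m + + 1) (proj₁ (W-special-bounds K₀ m)))

  aVoter-bVoter-separated : b ℕ.< a → ∀ K₀ x y → ¬ Interchangeable (game K₀) (aVoter x) (bVoter y)
  aVoter-bVoter-separated b<a K₀ x y =
    separated⇒¬interchangeable ab (W K₀) S
      (aVoter∉ ⊥ Y ⊥ (x∉avoiding x c)) (bVoter∉ ⊥ Y ⊥ Subset.∉⊥)
      (ℤ.≤-reflexive (trans (sym ca+a≡ab) (cong₂ _+_ (sym weight) (sym (W-aVoter K₀ x)))))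
      (subst (_< ab) (cong₂ _+_ (sym weight) (sym (W-bVoter K₀ y)))
        (ℤ.<-≤-trans (ℤ.+-monoʳ-< (+ c * + a) (+<+ b<a)) (ℤ.≤-reflexive ca+a≡ab)))
    where
    instance
      b≢0 : NonZero b
      b≢0 = ℕ.>-nonZero (ℕ.≤-<-trans z≤n (Fin.toℕ<n x))
    c = ℕ.pred b
    Y = avoiding x c
    S = coalition ⊥ Y ⊥
    weight : wsum (W K₀) S ≡ + c * + a
    weight = trans (wsum-coalition-⊥ (W K₀) (W-aVoter K₀) (W-bVoter K₀) Y ⊥)
      (trans (cong₂ (λ c d → + c * + a + + d * + b) (∣avoiding∣ x c<b) (Subset.∣⊥∣≡0 a))
             (ℤ.+-identityʳ _))
      where c<b = subst (c ℕ.<_) (ℕ.suc-pred b) (ℕ.n<1+n c)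
    ca+a≡ab : + c * + a + + a ≡ ab
    ca+a≡ab = trans (identity (+ a) (+ c))
                    (trans (cong (λ n → + a * + n) (ℕ.suc-pred b)) (sym (ℤ.pos-* a b)))
      where
      identity : ∀ A C → C * A + A ≡ A * (+ 1 + C)
      identity = solve-∀

  module _ (ŵ>a : ∀ m → + a < what a b l m) (l+1-rep : ∀ m → Representable a b (l m + + 1)) where

    l+1+a<ab : ∀ m → l m + + 1 + + a < ab
    l+1+a<ab m = ℤ.<-≤-trans (ℤ.+-monoʳ-< (l m + + 1) (ŵ>a m)) (ℤ.≤-reflexive (l+1+ŵ≡ab m))

    l+1-witness : ∀ m → ∃₂ λ u v → l m + + 1 ≡ + u * + a + + v * + b × u ℕ.< b × v ℕ.< a
    l+1-witness m = representable-below (l+1-rep m)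
      (ℤ.≤-<-trans (ℤ.i≤i+j (l m + + 1) (+ a)) (l+1+a<ab m))

    special-aVoter-separated : ∀ K₀ m x → ¬ Interchangeable (game K₀) (special m) (aVoter x)
    special-aVoter-separated K₀ m x with l+1-witness m
    ... | u , v , l+1≡ , u<b , v<a =
      special-separated K₀ m (avoiding x u) (prefix a v) l+1≡
        (∣avoiding∣ x u<b) (∣prefix∣ (ℕ.<⇒≤ v<a))
        (aVoter∉ ⊥ _ _ (x∉avoiding x u))
        (subst (λ w → l m + + 1 + w < ab) (sym (W-aVoter K₀ x)) (l+1+a<ab m))

    special-bVoter-separated : b ℕ.< a → ∀ K₀ m x → ¬ Interchangeable (game K₀) (special m) (bVoter x)
    special-bVoter-separated b<a K₀ m x with l+1-witness m
    ... | u , v , l+1≡ , u<b , v<a =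
      special-separated K₀ m (prefix b u) (avoiding x v) l+1≡
        (∣prefix∣ (ℕ.<⇒≤ u<b)) (∣avoiding∣ x v<a)
        (bVoter∉ ⊥ _ _ (x∉avoiding x v))
        (subst (λ w → l m + + 1 + w < ab) (sym (W-bVoter K₀ x))
          (ℤ.<-trans (ℤ.+-monoʳ-< (l m + + 1) (+<+ b<a)) (l+1+a<ab m)))

    specials-separated : (∀ i → ¬ Representable a b (l i)) → (∀ i j → i Fin.< j → l i < l j) →
                         ∀ K₀ {m m′} → m Fin.< m′ →
                         ¬ Interchangeable (game K₀) (special m) (special m′)
    specials-separated l-nonrep l-increasing K₀ {m} {m′} m<m′ with l+1-witness m
    ... | u , v , l+1≡ , u<b , v<a =
      special-separated K₀ m (prefix b u) (prefix a v) l+1≡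
        (∣prefix∣ (ℕ.<⇒≤ u<b)) (∣prefix∣ (ℕ.<⇒≤ v<a))
        (special∉ m′ _ _) light
      where
      l+1≢l′ : l m + + 1 ≢ l m′
      l+1≢l′ e = l-nonrep m′ (subst (Representable a b) e (l+1-rep m))
      l+1<l′ : l m + + 1 < l m′
      l+1<l′ = ℤ.≤∧≢⇒< (subst (_≤ l m′) (ℤ.+-comm (+ 1) (l m))
                                (ℤ.i<j⇒suc[i]≤j (l-increasing m m′ m<m′)))
                       l+1≢l′
      light : l m + + 1 + W K₀ (special m′) < ab
      light = begin-strict
        l m + + 1 + W K₀ (special m′)
          ≤⟨ ℤ.+-monoʳ-≤ (l m + + 1) (proj₂ (W-special-bounds K₀ m′)) ⟩
        l m + + 1 + (what a b l m′ + + 1)  <⟨ ℤ.+-monoˡ-< (what a b l m′ + + 1) l+1<l′ ⟩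
        l m′ + (what a b l m′ + + 1)       ≡⟨ shift (l m′) (what a b l m′) ⟩
        l m′ + + 1 + what a b l m′         ≡⟨ l+1+ŵ≡ab m′ ⟩
        ab                                 ∎
        where
        open ℤ.≤-Reasoning
        shift : ∀ L w → L + (w + + 1) ≡ L + + 1 + w
        shift = solve-∀

    W-preservesTypes : b ℕ.< a → (∀ i → ¬ Representable a b (l i)) →
                       (∀ i j → i Fin.< j → l i < l j) →
                       ∀ K₀ K → PreservesTypes (game K₀) (W K)
    W-preservesTypes b<a l-nonrep l-increasing K₀ K i j i~j with voter i | voter j
    ... | special′ m | special′ m′ with Fin.<-cmp m m′
    ...   | tri< m<m′ _ _ = ⊥-elim (specials-separated l-nonrep l-increasing K₀ m<m′ i~j)
    ...   | tri≈ _ refl _ = refl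
    ...   | tri> _ _ m′<m = ⊥-elim (specials-separated l-nonrep l-increasing K₀ m′<m j~i)
      where j~i = Interchangeable-sym (game K₀) i~j
    W-preservesTypes b<a _ _ K₀ K i j i~j | special′ m | aVoter′ x  =
      ⊥-elim (special-aVoter-separated K₀ m x i~j)
    W-preservesTypes b<a _ _ K₀ K i j i~j | special′ m | bVoter′ x  =
      ⊥-elim (special-bVoter-separated b<a K₀ m x i~j)
    W-preservesTypes b<a _ _ K₀ K i j i~j | aVoter′ x  | special′ m =
      ⊥-elim (special-aVoter-separated K₀ m x (Interchangeable-sym (game K₀) i~j))
    W-preservesTypes b<a _ _ K₀ K i j i~j | bVoter′ x  | special′ m =
      ⊥-elim (special-bVoter-separated b<a K₀ m x (Interchangeable-sym (game K₀) i~j))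
    W-preservesTypes b<a _ _ K₀ K i j i~j | aVoter′ x  | aVoter′ x′ =
      trans (W-aVoter K x) (sym (W-aVoter K x′))
    W-preservesTypes b<a _ _ K₀ K i j i~j | bVoter′ x  | bVoter′ x′ =
      trans (W-bVoter K x) (sym (W-bVoter K x′))
    W-preservesTypes b<a _ _ K₀ K i j i~j | aVoter′ x  | bVoter′ y  =
      ⊥-elim (aVoter-bVoter-separated b<a K₀ x y i~j)
    W-preservesTypes b<a _ _ K₀ K i j i~j | bVoter′ y  | aVoter′ x  =
      ⊥-elim (aVoter-bVoter-separated b<a K₀ x y (Interchangeable-sym (game K₀) i~j))

  R : ℤ
  R = total l + + 1 - (+ t - + 1) * ab

  wsum-W-special-⊤ : ∀ K → wsum (W K ∘ special) ⊤ ≡ ab - R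
  wsum-W-special-⊤ K = begin
    wsum (W K ∘ special) ⊤                     ≡⟨ wsum-W-special K ⊤ ⟩
    + ∣ ⊤ {t} ∣ * ab - total l - wsum (δ K) ⊤
      ≡⟨ cong₂ (λ c d → + c * ab - total l - d) (Subset.∣⊤∣≡n t) (wsum-δ-∈ Subset.∈⊤) ⟩
    + t * ab - total l - + 1                   ≡⟨ identity (+ t) ab (total l) ⟩
    ab - R                                     ∎
    where
    open ≡-Reasoning
    identity : ∀ T A L → T * A - L - + 1 ≡ A - (L + + 1 - (T - + 1) * A)
    identity = solve-∀

  W-total : ∀ K {u v} → R ≡ + u * + a + + v * + b →
            total (W K) ≡ + a * + b - (+ u * + a + + v * + b) + (+ b * + a + + a * + b)
  W-total K {u} {v} R≡ = begin
    total (W K)                                       ≡⟨ total-coalition (W K) (W-aVoter K) (W-bVoter K) ⟩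
    wsum (W K ∘ special) ⊤ + (+ b * + a + + a * + b)
      ≡⟨ cong (λ s → s + (+ b * + a + + a * + b)) (wsum-W-special-⊤ K) ⟩
    ab - R + (+ b * + a + + a * + b)
      ≡⟨ cong₂ (λ A r → A - r + (+ b * + a + + a * + b)) (ℤ.pos-* a b) R≡ ⟩
    + a * + b - (+ u * + a + + v * + b) + (+ b * + a + + a * + b) ∎
    where open ≡-Reasoning

  module TypePreservingRep (K₀ : Fin t) {q : ℤ} {w : Fin N → ℤ}
                           (rep : IsIntRep (game K₀) q w) (w-types : PreservesTypes (game K₀) w)
                           (0<a : 0 ℕ.< a) (0<b : 0 ℕ.< b) where

    wins : ∀ S → ab ≤ wsum (W K₀) S → q ≤ wsum w S
    wins = proj₁ (proj₂ rep)

    loses : ∀ S → wsum (W K₀) S < ab → wsum w S ≤ q - + 1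
    loses S lt = proj₂ (proj₂ rep) S (ℤ.<⇒≱ lt)

    y z : ℤ
    y = w (aVoter (Fin.fromℕ< 0<b))
    z = w (bVoter (Fin.fromℕ< 0<a))

    w-aVoter : ∀ x → w (aVoter x) ≡ y
    w-aVoter x = w-types _ _
      (weightedGame-interchangeable ab (W K₀) (trans (W-aVoter K₀ x) (sym (W-aVoter K₀ _))))

    w-bVoter : ∀ x → w (bVoter x) ≡ z
    w-bVoter x = w-types _ _
      (weightedGame-interchangeable ab (W K₀) (trans (W-bVoter K₀ x) (sym (W-bVoter K₀ _))))

    blocks : ℕ → ℕ → Subset N
    blocks u v = coalition ⊥ (prefix b u) (prefix a v)

    W-blocks : ∀ {u v} → u ℕ.≤ b → v ℕ.≤ a → wsum (W K₀) (blocks u v) ≡ + u * + a + + v * + b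
    W-blocks {u} {v} u≤b v≤a = trans (wsum-coalition-⊥ (W K₀) (W-aVoter K₀) (W-bVoter K₀) _ _)
      (cong₂ (λ c d → + c * + a + + d * + b) (∣prefix∣ u≤b) (∣prefix∣ v≤a))

    w-blocks : ∀ {u v} → u ℕ.≤ b → v ℕ.≤ a → wsum w (blocks u v) ≡ + u * y + + v * z
    w-blocks {u} {v} u≤b v≤a = trans (wsum-coalition-⊥ w w-aVoter w-bVoter _ _)
      (cong₂ (λ c d → + c * y + + d * z) (∣prefix∣ u≤b) (∣prefix∣ v≤a))

    aVoters-win : q ≤ + b * y
    aVoters-win = subst (q ≤_) (trans (w-blocks ℕ.≤-refl z≤n) (ℤ.+-identityʳ _))
      (wins (blocks b 0) (ℤ.≤-reflexive (trans (ℤ.pos-* a b) (trans (ℤ.*-comm (+ a) (+ b))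
        (sym (trans (W-blocks ℕ.≤-refl z≤n) (ℤ.+-identityʳ _)))))))

    bVoters-win : q ≤ + a * z
    bVoters-win = subst (q ≤_) (trans (w-blocks z≤n ℕ.≤-refl) (ℤ.+-identityˡ _))
      (wins (blocks 0 a) (ℤ.≤-reflexive (trans (ℤ.pos-* a b)
        (sym (trans (W-blocks z≤n ℕ.≤-refl) (ℤ.+-identityˡ _))))))

    blocks-lose : ∀ {u₀ v₀} → u₀ ℕ.* a ℕ.+ v₀ ℕ.* b ℕ.+ 1 ≡ a ℕ.* b →
                  + u₀ * y + + v₀ * z ≤ q - + 1
    blocks-lose {u₀} {v₀} rel = subst (_≤ q - + 1) (w-blocks u₀≤b v₀≤a) (loses (blocks u₀ v₀)
      (subst (_< ab) (sym (trans (W-blocks u₀≤b v₀≤a) (pos-combination u₀ a v₀ b))) (+<+ lt)))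
      where
      lt = subst (u₀ ℕ.* a ℕ.+ v₀ ℕ.* b ℕ.<_) rel (ℕ.m<m+n _ ℕ.0<1+n)
      u₀≤b = ℕ.<⇒≤ (proj₁ (representable-bounds u₀ v₀ lt))
      v₀≤a = ℕ.<⇒≤ (proj₂ (representable-bounds u₀ v₀ lt))

    block-bounds : Coprime a b → + a ≤ y × + b ≤ z × + a * + b ≤ q
    block-bounds coprime with coprime⇒ab∸1-representable {{ℕ.>-nonZero 0<a}} {{ℕ.>-nonZero 0<b}} coprime
    ... | u₀ , v₀ , rel = forced-bounds {u₀ = u₀} {v₀} {q} {y} {z} rel aVoters-win bVoters-win
                                         (blocks-lose {u₀} {v₀} rel)

    specials-win : ∀ {u v} → R ≡ + u * + a + + v * + b → u ℕ.≤ b → v ℕ.≤ a →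
                   q ≤ wsum (w ∘ special) ⊤ + (+ u * y + + v * z)
    specials-win {u} {v} R≡ u≤b v≤a =
      subst (q ≤_) (wsum-coalition-prefix w w-aVoter w-bVoter ⊤ u≤b v≤a)
        (wins (coalition ⊤ (prefix b u) (prefix a v)) (ℤ.≤-reflexive (sym (begin
          wsum (W K₀) (coalition ⊤ (prefix b u) (prefix a v))
            ≡⟨ wsum-coalition-prefix (W K₀) (W-aVoter K₀) (W-bVoter K₀) ⊤ u≤b v≤a ⟩
          wsum (W K₀ ∘ special) ⊤ + (+ u * + a + + v * + b)
            ≡⟨ cong₂ _+_ (wsum-W-special-⊤ K₀) (sym R≡) ⟩
          ab - R + R                                         ≡⟨ cancel ab R ⟩
          ab                                                 ∎))))
      where
      open ≡-Reasoning
      cancel : ∀ A R → A - R + R ≡ A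
      cancel = solve-∀

  W-minimal : Coprime a b → 0 ℕ.< a → 0 ℕ.< b → Representable a b R → R < ab →
              ∀ K₀ K q w → IsIntRep (game K₀) q w → PreservesTypes (game K₀) w → total (W K) ≤ total w
  W-minimal coprime 0<a 0<b R-rep R<ab K₀ K q w rep w-types with representable-below R-rep R<ab
  ... | u , v , R≡ , u<b , v<a = begin
    total (W K)                                                   ≡⟨ W-total K {u} {v} R≡ ⟩
    + a * + b - (+ u * + a + + v * + b) + (+ b * + a + + a * + b)
      ≤⟨ total-bound {u = u} {v} {q} {y} {z} {wsum (w ∘ special) ⊤} a≤y b≤z ab≤q u≤b v≤a
                     (specials-win {u} {v} R≡ u≤b v≤a) ⟩
    wsum (w ∘ special) ⊤ + (+ b * y + + a * z)
      ≡⟨ total-coalition w w-aVoter w-bVoter ⟨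
    total w                                                       ∎
    where
    open TypePreservingRep K₀ rep w-types 0<a 0<b
    open ℤ.≤-Reasoning
    u≤b = ℕ.<⇒≤ u<b
    v≤a = ℕ.<⇒≤ v<a
    bounds = block-bounds coprime
    a≤y = proj₁ bounds
    b≤z = proj₁ (proj₂ bounds)
    ab≤q = proj₂ (proj₂ bounds)

mainTheorem4 : (a b t : ℕ) → 0 ℕ.< b → b ℕ.< a → Coprime a b → 2 ℕ.≤ t →
    (l : Fin t → ℤ) →
    (∀ i j → i Fin.< j → l i < l j) →
    (∀ i → (+ a < what a b l i) × (what a b l i < + (a ℕ.* b) - + 1) ×
           ¬ Representable a b (l i) × Representable a b (l i + + 1)) →
    (∀ (S : Subset t) → 2 ℕ.≤ ∣ S ∣ → ∣ S ∣ ℕ.< t →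
       (+ 0 < wsum l S - (+ ∣ S ∣ - + 1) * + (a ℕ.* b)) ×
       (wsum l S - (+ ∣ S ∣ - + 1) * + (a ℕ.* b) < + (a ℕ.* b)) ×
       ¬ Representable a b (wsum l S - (+ ∣ S ∣ - + 1) * + (a ℕ.* b))) →
    (+ 0 < total l + + 1 - (+ t - + 1) * + (a ℕ.* b)) ×
    (total l + + 1 - (+ t - + 1) * + (a ℕ.* b) < + (a ℕ.* b)) ×
    Representable a b (total l + + 1 - (+ t - + 1) * + (a ℕ.* b)) →
    (k : Fin t) →
    IsMinSumRepPT (weightedGame (+ (a ℕ.* b)) (repWeights a b t l 0))
                  (+ (a ℕ.* b)) (repWeights a b t l (toℕ k))
mainTheorem4 a b t 0<b b<a coprime (s≤s (s≤s z≤n)) l l-increasing singles sums (_ , R<ab , R-rep) k =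
    W-isIntRep nonrep (λ m → ℤ.<⇒≤ (ℤ.≤-<-trans (0≤ℕ a) (ŵ>a m))) Fin.zero k
  , W-preservesTypes ŵ>a l+1-rep b<a l-nonrep l-increasing Fin.zero k
  , W-minimal coprime (ℕ.<-trans 0<b b<a) 0<b R-rep R<ab Fin.zero k
  where
  open Theorem4Game a b t l
  ŵ>a = λ m → proj₁ (singles m)
  l-nonrep = λ m → proj₁ (proj₂ (proj₂ (singles m)))
  l+1-rep = λ m → proj₂ (proj₂ (proj₂ (singles m)))
  nonrep = properSums-nonRepresentable l-nonrep
             (λ X 2≤∣X∣ ∣X∣<t → proj₂ (proj₂ (sums X 2≤∣X∣ ∣X∣<t)))
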